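{- Let $n\geq0$ and let $\alpha_0,\alpha_1,\ldots,\alpha_m$ be integers with $\alpha_0\geq0$, $\alpha_i>0$ for $i=1,\ldots,m$, and $\sum_{i=0}^m\alpha_i=n$. Then $$K[\alpha_0+1,\alpha_1,\ldots,\alpha_{m-1},\alpha_m+1]\leq K[1^n,2]=K[2,1^n]=F_{n+1},$$ with equality if and only if either $m=n$, $\alpha_0=0$ and $\alpha_1=\cdots=\alpha_n=1$, or $m=n-1$ and $\alpha_0=\alpha_1=\cdots=\alpha_{n-1}=1$. (For $m=0$ the left-hand side is interpreted as $K[\alpha_0+2]$.)
   Context: Continuants are defined by $K[\,]=1$, $K[a_0]=a_0$, and $K[a_0,\ldots,a_n]=a_nK[a_0,\ldots,a_{n-1}]+K[a_0,\ldots,a_{n-2}]$ for $n\geq1$. $1^n$ denotes the sequence $(1,\ldots,1)$ of length $n$. Fibonacci numbers: $F_{ -1}=F_0=1$, $F_{n+1}=F_n+F_{n-1}$ for $n\geq0$. -}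

module Defs where

open import Data.Nat using (ℕ; zero; suc; _+_; _*_)
open import Data.List using (List; []; _∷_; reverse)

-- Krev takes the sequence in reversed order (last entry first).
Krev : List ℕ → ℕ
Krev [] = 1
Krev (a ∷ []) = a
Krev (a ∷ b ∷ r) = a * Krev (b ∷ r) + Krev r

K : List ℕ → ℕ
K xs = Krev (reverse xs)

-- Fibonacci with F₋₁ = F₀ = 1; here F n denotes F_n for n ≥ 0
-- (so F 0 = 1, F 1 = F₀ + F₋₁ = 2, F (n+2) = F (n+1) + F n).
F : ℕ → ℕ
F zero = 1
F (suc zero) = 2
F (suc (suc n)) = F (suc n) + F n

incLast : List ℕ → List ℕ
incLast [] = []
incLast (x ∷ []) = suc x ∷ []
incLast (x ∷ y ∷ r) = x ∷ incLast (y ∷ r)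

lhsSeq : ℕ → List ℕ → List ℕ
lhsSeq a₀ [] = (a₀ + 2) ∷ []
lhsSeq a₀ (x ∷ r) = (a₀ + 1) ∷ incLast (x ∷ r)

module Submission where

-- Proof strategy.  Write fib for the Fibonacci numbers with fib 0 = fib 1 = 1,
-- so that F n = fib (n + 1).  Everything rests on one general fact about
-- continuants of positive sequences xs:
--
--   K xs ≤ fib (sum xs),  with equality  iff  xs is 1^k, 1^k 2, 2 1^k, 2 1^k 2 or 3.
--
-- Finally the
-- sequence [α₀+1, α₁, …, α_m+1] of the theorem is positive with sum n+2, both
-- 1^n 2 and 2 1^n attain fib (n+2), and the sequence is extremal exactly when
-- α₀ ≤ 1 and all αᵢ = 1, which is the stated equality condition.

open import Defs
open import Data.Nat using (ℕ; zero; suc; _+_; _*_; _<_; _≤_; z≤n; s≤s; _≤′_; ≤′-refl; ≤′-step)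
open import Data.Nat.Properties
open import Data.Nat.ListAction using (sum)
open import Data.Nat.Tactic.RingSolver using (solve-∀)
open import Data.List using (List; []; _∷_; _++_; replicate; length; reverse)
open import Data.List.Properties using (unfold-reverse; reverse-++)
open import Data.List.Relation.Unary.All using (All; []; _∷_)
open import Data.Product using (_×_; _,_; proj₁; proj₂)
open import Data.Sum using (_⊎_; inj₁; inj₂)
open import Data.Empty using (⊥-elim)
open import Function.Bundles using (_⇔_; mk⇔)
open import Function.Properties.Equivalence using () renaming (trans to ⇔-trans)
open import Relation.Binary.PropositionalEquality using (_≡_; _≢_; refl; sym; trans; cong; cong₂; subst; module ≡-Reasoning)

Krev-snoc : ∀ xs b c → Krev (xs ++ b ∷ c ∷ []) ≡ c * Krev (xs ++ b ∷ []) + Krev xs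
Krev-snoc [] b c = cong (_+ 1) (*-comm b c)
Krev-snoc (a ∷ []) b c = identity a b c
  where
  identity : ∀ a b c → a * (b * c + 1) + c ≡ c * (a * b + 1) + a
  identity = solve-∀
Krev-snoc (a ∷ a′ ∷ t) b c
  rewrite Krev-snoc (a′ ∷ t) b c | Krev-snoc t b c =
  identity a c (Krev (a′ ∷ t ++ b ∷ [])) (Krev (t ++ b ∷ [])) (Krev (a′ ∷ t)) (Krev t)
  where
  identity : ∀ a c P Q R S → a * (c * P + R) + (c * Q + S) ≡ c * (a * P + Q) + (a * R + S)
  identity = solve-∀

K≡Krev : ∀ xs → K xs ≡ Krev xs
K≡Krev [] = refl
K≡Krev (a ∷ []) = refl
K≡Krev (a ∷ b ∷ r) = begin
  Krev (reverse (a ∷ b ∷ r))                          ≡⟨ cong Krev (reverse-++ (a ∷ b ∷ []) r) ⟩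
  Krev (reverse r ++ b ∷ a ∷ [])                      ≡⟨ Krev-snoc (reverse r) b a ⟩
  a * Krev (reverse r ++ b ∷ []) + Krev (reverse r)
    ≡⟨ cong₂ (λ x y → a * Krev x + y) (sym (unfold-reverse b r)) (K≡Krev r) ⟩
  a * Krev (reverse (b ∷ r)) + Krev r                 ≡⟨ cong (λ x → a * x + Krev r) (K≡Krev (b ∷ r)) ⟩
  Krev (a ∷ b ∷ r)                                    ∎
  where open ≡-Reasoning

fib : ℕ → ℕ
fib zero = 1
fib (suc zero) = 1
fib (suc (suc n)) = fib (suc n) + fib n

F≡fib : ∀ n → F n ≡ fib (suc n)
F≡fib zero = refl
F≡fib (suc zero) = refl
F≡fib (suc (suc n)) = cong₂ _+_ (F≡fib (suc n)) (F≡fib n)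

fib-step : ∀ n → fib n ≤ fib (suc n)
fib-step zero = ≤-refl
fib-step (suc n) = m≤m+n (fib (suc n)) (fib n)

fib-mono : ∀ {m n} → m ≤ n → fib m ≤ fib n
fib-mono m≤n = go (≤⇒≤′ m≤n)
  where
  go : ∀ {m n} → m ≤′ n → fib m ≤ fib n
  go ≤′-refl = ≤-refl
  go (≤′-step {n} m≤′n) = ≤-trans (go m≤′n) (fib-step n)

fib-pos : ∀ n → 1 ≤ fib n
fib-pos n = fib-mono {0} {n} z≤n

fib-≥-id : ∀ n → n ≤ fib n
fib-≥-id zero = z≤n
fib-≥-id (suc zero) = ≤-refl
fib-≥-id (suc (suc n)) =
  ≤-trans (≤-reflexive (+-comm 1 (suc n))) (+-mono-≤ (fib-≥-id (suc n)) (fib-pos n))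

fib-beyond-4 : ∀ k → 4 + k < fib (4 + k)
fib-beyond-4 k = ≤-trans (≤-reflexive (+-comm 2 (3 + k)))
  (+-mono-≤ (fib-≥-id (3 + k)) (fib-mono {2} {2 + k} (s≤s (s≤s z≤n))))

fib-gap : ∀ b s → fib s ≡ fib (b + s) → b ≡ 0 ⊎ (b ≡ 1 × s ≡ 0)
fib-gap zero s _ = inj₁ refl
fib-gap (suc zero) zero _ = inj₂ (refl , refl)
fib-gap (suc zero) (suc u) e = ⊥-elim (<⇒≢ (m<m+n (fib (suc u)) (fib-pos u)) e)
fib-gap (suc (suc k)) s e = ⊥-elim (<⇒≢ fib-s<fib-2+k+s e)
  where
  fib-s<fib-2+k+s : fib s < fib (suc (suc k) + s)
  fib-s<fib-2+k+s = <-≤-trans (m<n+m (fib s) (fib-pos (suc s)))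
    (fib-mono (s≤s (s≤s (m≤n+m s k))))

-- Prepending an entry a+1 in front of a sequence whose tails reach the
-- Fibonacci bound: (a+1)·fib (t+1) + fib t ≤ fib (a+1 + t+1).
fib-linear : ∀ a t → suc a * fib (suc t) + fib t ≤ fib (suc a + suc t)
fib-linear zero t = ≤-reflexive (cong (_+ fib t) (+-identityʳ (fib (suc t))))
fib-linear (suc a) t = begin
  (fib (suc t) + suc a * fib (suc t)) + fib t    ≡⟨ +-assoc (fib (suc t)) _ (fib t) ⟩
  fib (suc t) + (suc a * fib (suc t) + fib t)    ≤⟨ +-mono-≤ (fib-mono (m≤n+m (suc t) a)) (fib-linear a t) ⟩
  fib (a + suc t) + fib (suc a + suc t)          ≡⟨ +-comm (fib (a + suc t)) _ ⟩
  fib (suc (suc a) + suc t)                      ∎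
  where open ≤-Reasoning

+-tight : ∀ {p p′ q q′} → p ≤ p′ → q ≤ q′ → p + q ≡ p′ + q′ → p ≡ p′
+-tight {p} {p′} {q} hp hq e =
  ≤-antisym hp (+-cancelʳ-≤ q p′ p (≤-trans (+-monoʳ-≤ p′ hq) (≤-reflexive (sym e))))

chain-tight : ∀ {x y z w} → x ≤ y → y ≤ z → z ≤ w → w ≤ x → x ≡ y × y ≡ z × z ≡ w
chain-tight x≤y y≤z z≤w w≤x =
  ≤-antisym x≤y (≤-trans y≤z (≤-trans z≤w w≤x)) ,
  ≤-antisym y≤z (≤-trans z≤w (≤-trans w≤x x≤y)) ,
  ≤-antisym z≤w (≤-trans w≤x (≤-trans x≤y y≤z))

fib-linear-tight : ∀ a t → suc a * fib (suc t) + fib t ≡ fib (suc a + suc t) → a ≡ 0 ⊎ a ≡ 1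
fib-linear-tight zero t _ = inj₁ refl
fib-linear-tight (suc a) t e with fib-gap a (suc t) first-term-tight
  where
  -- In the inductive step of fib-linear, the bound fib (t+1) ≤ fib (a+t+1) must be tight.
  first-term-tight : fib (suc t) ≡ fib (a + suc t)
  first-term-tight = +-tight (fib-mono (m≤n+m (suc t) a)) (fib-linear a t)
    (trans (sym (+-assoc (fib (suc t)) _ (fib t))) (trans e (+-comm _ (fib (a + suc t)))))
... | inj₁ refl = inj₂ refl
... | inj₂ (_ , ())

AllPositive : List ℕ → Set
AllPositive = All (0 <_)

Krev-bound : ∀ xs → AllPositive xs → Krev xs ≤ fib (sum xs)
Krev-bound [] _ = ≤-refl
Krev-bound (a ∷ []) _ = subst (λ m → a ≤ fib m) (sym (+-identityʳ a)) (fib-≥-id a)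
Krev-bound (zero ∷ _ ∷ _) (() ∷ _)
Krev-bound (suc a ∷ zero ∷ _) (_ ∷ () ∷ _)
Krev-bound (suc a ∷ suc b ∷ r) (_ ∷ pos@(_ ∷ pos′)) = begin
  suc a * Krev (suc b ∷ r) + Krev r
    ≤⟨ +-mono-≤ (*-monoʳ-≤ (suc a) (Krev-bound (suc b ∷ r) pos)) (Krev-bound r pos′) ⟩
  suc a * fib (suc (b + sum r)) + fib (sum r)
    ≤⟨ +-monoʳ-≤ (suc a * _) (fib-mono (m≤n+m (sum r) b)) ⟩
  suc a * fib (suc (b + sum r)) + fib (b + sum r)
    ≤⟨ fib-linear a (b + sum r) ⟩
  fib (suc a + (suc b + sum r)) ∎
  where open ≤-Reasoning

data Ones12 : List ℕ → Set where
  none : Ones12 []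
  two : Ones12 (2 ∷ [])
  one∷_ : ∀ {xs} → Ones12 xs → Ones12 (1 ∷ xs)

data Extremal : List ℕ → Set where
  ones : ∀ {xs} → Ones12 xs → Extremal xs
  two∷_ : ∀ {xs} → Ones12 xs → Extremal (2 ∷ xs)
  three : Extremal (3 ∷ [])

Ones12-value : ∀ {xs} → Ones12 xs → Krev xs ≡ fib (sum xs)
Ones12-value none = refl
Ones12-value two = refl
Ones12-value (one∷ none) = refl
Ones12-value (one∷ two) = refl
Ones12-value (one∷ (one∷ o)) =
  cong₂ _+_ (trans (*-identityˡ _) (Ones12-value (one∷ o))) (Ones12-value o)

Extremal-value : ∀ {xs} → Extremal xs → Krev xs ≡ fib (sum xs)
Extremal-value (ones o) = Ones12-value o
Extremal-value three = refl
Extremal-value (two∷ none) = refl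
Extremal-value (two∷ two) = refl
Extremal-value (two∷ (one∷_ {xs} o)) =
  trans (cong₂ (λ x y → 2 * x + y) (Ones12-value (one∷ o)) (Ones12-value o))
    (identity (fib (suc (sum xs))) (fib (sum xs)))
  where
  identity : ∀ x y → 2 * x + y ≡ (x + y) + x
  identity = solve-∀

Extremal-prepend : ∀ {a b r} → a ≡ 0 ⊎ a ≡ 1 → b ≡ 0 ⊎ (b ≡ 1 × r ≡ []) →
  Extremal (suc b ∷ r) → Extremal (suc a ∷ suc b ∷ r)
Extremal-prepend (inj₁ refl) (inj₁ refl) (ones o) = ones (one∷ o)
Extremal-prepend (inj₂ refl) (inj₁ refl) (ones o) = two∷ o
Extremal-prepend (inj₁ refl) (inj₂ (refl , refl)) _ = ones (one∷ two)
Extremal-prepend (inj₂ refl) (inj₂ (refl , refl)) _ = two∷ two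

sum-zero : ∀ r → AllPositive r → sum r ≡ 0 → r ≡ []
sum-zero [] _ _ = refl
sum-zero (zero ∷ _) (() ∷ _) _
sum-zero (suc _ ∷ _) _ ()

-- Equality in Krev-bound forces the sequence to be extremal: every step of
-- the chain in Krev-bound must be tight.
Krev-extremal : ∀ xs → AllPositive xs → Krev xs ≡ fib (sum xs) → Extremal xs
Krev-extremal [] _ _ = ones none
Krev-extremal (zero ∷ []) (() ∷ _) _
Krev-extremal (suc zero ∷ []) _ _ = ones (one∷ none)
Krev-extremal (suc (suc zero) ∷ []) _ _ = ones two
Krev-extremal (suc (suc (suc zero)) ∷ []) _ _ = three
Krev-extremal (suc (suc (suc (suc k))) ∷ []) _ e =
  ⊥-elim (<⇒≢ (fib-beyond-4 k) (trans e (cong fib (+-identityʳ (4 + k)))))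
Krev-extremal (zero ∷ _ ∷ _) (() ∷ _)
Krev-extremal (suc a ∷ zero ∷ _) (_ ∷ () ∷ _)
Krev-extremal (suc a ∷ suc b ∷ r) (_ ∷ pos@(_ ∷ pos′)) e =
  Extremal-prepend first-entry second-entry (Krev-extremal (suc b ∷ r) pos tail-tight)
  where
  t : ℕ
  t = b + sum r
  K₁≤ : suc a * Krev (suc b ∷ r) ≤ suc a * fib (suc t)
  K₁≤ = *-monoʳ-≤ (suc a) (Krev-bound (suc b ∷ r) pos)
  K₂≤ : Krev r ≤ fib (sum r)
  K₂≤ = Krev-bound r pos′
  tight : suc a * Krev (suc b ∷ r) + Krev r ≡ suc a * fib (suc t) + fib (sum r)
        × suc a * fib (suc t) + fib (sum r) ≡ suc a * fib (suc t) + fib t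
        × suc a * fib (suc t) + fib t ≡ fib (suc a + suc t)
  tight = chain-tight (+-mono-≤ K₁≤ K₂≤) (+-monoʳ-≤ (suc a * _) (fib-mono (m≤n+m (sum r) b)))
    (fib-linear a t) (≤-reflexive (sym e))
  tail-tight : Krev (suc b ∷ r) ≡ fib (suc t)
  tail-tight = *-cancelˡ-≡ _ _ (suc a) (+-tight K₁≤ K₂≤ (proj₁ tight))
  first-entry : a ≡ 0 ⊎ a ≡ 1
  first-entry = fib-linear-tight a t (proj₂ (proj₂ tight))
  second-entry : b ≡ 0 ⊎ (b ≡ 1 × r ≡ [])
  second-entry with fib-gap b (sum r) (+-cancelˡ-≡ _ _ _ (proj₁ (proj₂ tight)))
  ... | inj₁ b≡0 = inj₁ b≡0
  ... | inj₂ (b≡1 , sum≡0) = inj₂ (b≡1 , sum-zero r pos′ sum≡0)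

K-bound : ∀ {xs} → AllPositive xs → K xs ≤ fib (sum xs)
K-bound {xs} pos = ≤-trans (≤-reflexive (K≡Krev xs)) (Krev-bound xs pos)

K-value : ∀ {xs} → Extremal xs → K xs ≡ fib (sum xs)
K-value {xs} ex = trans (K≡Krev xs) (Extremal-value ex)

K-extremal⇔ : ∀ {xs} → AllPositive xs → (K xs ≡ fib (sum xs)) ⇔ Extremal xs
K-extremal⇔ {xs} pos = mk⇔ (λ e → Krev-extremal xs pos (trans (sym (K≡Krev xs)) e)) K-value

sum-ones : ∀ n → sum (replicate n 1) ≡ n
sum-ones zero = refl
sum-ones (suc n) = cong suc (sum-ones n)

sum-ones-two : ∀ n → sum (replicate n 1 ++ 2 ∷ []) ≡ 2 + n
sum-ones-two zero = refl
sum-ones-two (suc n) = cong suc (sum-ones-two n)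

Ones12-ones : ∀ n → Ones12 (replicate n 1)
Ones12-ones zero = none
Ones12-ones (suc n) = one∷ Ones12-ones n

Ones12-ones-two : ∀ n → Ones12 (replicate n 1 ++ 2 ∷ [])
Ones12-ones-two zero = two
Ones12-ones-two (suc n) = one∷ Ones12-ones-two n

K-ones-two : ∀ n → K (replicate n 1 ++ 2 ∷ []) ≡ fib (2 + n)
K-ones-two n = trans (K-value (ones (Ones12-ones-two n))) (cong fib (sum-ones-two n))

K-two-ones : ∀ n → K (2 ∷ replicate n 1) ≡ fib (2 + n)
K-two-ones n = trans (K-value (two∷ Ones12-ones n)) (cong (λ m → fib (2 + m)) (sum-ones n))

F-succ : ∀ n → F (n + 1) ≡ fib (2 + n)
F-succ n = trans (F≡fib (n + 1)) (cong (λ m → fib (suc m)) (+-comm n 1))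

incLast-nonempty : ∀ x r → incLast (x ∷ r) ≢ []
incLast-nonempty x [] ()
incLast-nonempty x (y ∷ r) ()

incLast-positive : ∀ x r → AllPositive (x ∷ r) → AllPositive (incLast (x ∷ r))
incLast-positive x [] _ = s≤s z≤n ∷ []
incLast-positive x (y ∷ r) (px ∷ pr) = px ∷ incLast-positive y r pr

incLast-sum : ∀ x r → sum (incLast (x ∷ r)) ≡ suc (sum (x ∷ r))
incLast-sum x [] = refl
incLast-sum x (y ∷ r) = trans (cong (x +_) (incLast-sum y r)) (+-suc x _)

lhsSeq-positive : ∀ α₀ αs → AllPositive αs → AllPositive (lhsSeq α₀ αs)
lhsSeq-positive α₀ [] _ = ≤-trans (s≤s z≤n) (m≤n+m 2 α₀) ∷ []
lhsSeq-positive α₀ (x ∷ r) pos = m≤n+m 1 α₀ ∷ incLast-positive x r pos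

lhsSeq-sum : ∀ α₀ αs → sum (lhsSeq α₀ αs) ≡ 2 + (α₀ + sum αs)
lhsSeq-sum α₀ [] = identity α₀
  where
  identity : ∀ a → a + 2 + 0 ≡ 2 + (a + 0)
  identity = solve-∀
lhsSeq-sum α₀ (x ∷ r) = trans (cong (α₀ + 1 +_) (incLast-sum x r)) (identity α₀ (sum (x ∷ r)))
  where
  identity : ∀ a s → a + 1 + suc s ≡ 2 + (a + s)
  identity = solve-∀

Ones12-incLast : ∀ {x r} → All (_≡ 1) (x ∷ r) → Ones12 (incLast (x ∷ r))
Ones12-incLast {r = []} (refl ∷ []) = two
Ones12-incLast {r = y ∷ r} (refl ∷ all-1) = one∷ Ones12-incLast all-1

Ones12-∷ : ∀ {x xs} → Ones12 (x ∷ xs) → xs ≢ [] → x ≡ 1 × Ones12 xs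
Ones12-∷ (one∷ o) _ = refl , o
Ones12-∷ two xs≢[] = ⊥-elim (xs≢[] refl)

incLast-Ones12 : ∀ x r → AllPositive (x ∷ r) → Ones12 (incLast (x ∷ r)) → All (_≡ 1) (x ∷ r)
incLast-Ones12 zero [] (() ∷ _) _
incLast-Ones12 (suc x) [] _ two = refl ∷ []
incLast-Ones12 x (y ∷ r) (_ ∷ pos) o with Ones12-∷ o (incLast-nonempty y r)
... | refl , o′ = refl ∷ incLast-Ones12 y r pos o′

Extremal-singleton : ∀ {k} → Extremal (suc (suc k) ∷ []) → k ≡ 0 ⊎ k ≡ 1
Extremal-singleton (ones two) = inj₁ refl
Extremal-singleton (two∷ none) = inj₁ refl
Extremal-singleton three = inj₂ refl

Extremal-∷ : ∀ {a xs} → Extremal (suc a ∷ xs) → xs ≢ [] → (a ≡ 0 ⊎ a ≡ 1) × Ones12 xs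
Extremal-∷ (ones o) xs≢[] with Ones12-∷ o xs≢[]
... | refl , o′ = inj₁ refl , o′
Extremal-∷ (two∷ o) _ = inj₂ refl , o
Extremal-∷ three xs≢[] = ⊥-elim (xs≢[] refl)

lhsSeq-extremal⇔ : ∀ α₀ {αs} → AllPositive αs →
  Extremal (lhsSeq α₀ αs) ⇔ ((α₀ ≡ 0 ⊎ α₀ ≡ 1) × All (_≡ 1) αs)
lhsSeq-extremal⇔ α₀ {αs} pos = mk⇔ (to αs pos) from
  where
  to : ∀ αs → AllPositive αs → Extremal (lhsSeq α₀ αs) → (α₀ ≡ 0 ⊎ α₀ ≡ 1) × All (_≡ 1) αs
  to [] _ ex = Extremal-singleton (subst (λ h → Extremal (h ∷ [])) (+-comm α₀ 2) ex) , []
  to (x ∷ r) pos ex with Extremal-∷ (subst (λ h → Extremal (h ∷ incLast (x ∷ r))) (+-comm α₀ 1) ex)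
                                     (incLast-nonempty x r)
  ... | α₀≤1 , o = α₀≤1 , incLast-Ones12 x r pos o
  from : ∀ {α₀ αs} → (α₀ ≡ 0 ⊎ α₀ ≡ 1) × All (_≡ 1) αs → Extremal (lhsSeq α₀ αs)
  from (inj₁ refl , []) = ones two
  from (inj₁ refl , all-1@(_ ∷ _)) = ones (one∷ Ones12-incLast all-1)
  from (inj₂ refl , []) = three
  from (inj₂ refl , all-1@(_ ∷ _)) = two∷ Ones12-incLast all-1

length-ones : ∀ {xs} → All (_≡ 1) xs → length xs ≡ sum xs
length-ones [] = refl
length-ones (refl ∷ all-1) = cong suc (length-ones all-1)

EqualityCondition : ℕ → ℕ → List ℕ → Set
EqualityCondition n α₀ αs = (length αs ≡ n × α₀ ≡ 0 × All (λ a → a ≡ 1) αs)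
                          ⊎ (length αs + 1 ≡ n × α₀ ≡ 1 × All (λ a → a ≡ 1) αs)

condition⇔ : ∀ {n α₀ αs} → α₀ + sum αs ≡ n →
  ((α₀ ≡ 0 ⊎ α₀ ≡ 1) × All (_≡ 1) αs) ⇔ EqualityCondition n α₀ αs
condition⇔ {n} {α₀} {αs} total = mk⇔ to from
  where
  to : (α₀ ≡ 0 ⊎ α₀ ≡ 1) × All (_≡ 1) αs → EqualityCondition n α₀ αs
  to (inj₁ refl , all-1) = inj₁ (trans (length-ones all-1) total , refl , all-1)
  to (inj₂ refl , all-1) =
    inj₂ (trans (+-comm (length αs) 1) (trans (cong suc (length-ones all-1)) total) , refl , all-1)
  from : EqualityCondition n α₀ αs → (α₀ ≡ 0 ⊎ α₀ ≡ 1) × All (_≡ 1) αs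
  from (inj₁ (_ , refl , all-1)) = inj₁ refl , all-1
  from (inj₂ (_ , refl , all-1)) = inj₂ refl , all-1

theorem5p3 : (n α₀ : ℕ) (αs : List ℕ) → All (λ a → 0 < a) αs → α₀ + sum αs ≡ n →
    (K (lhsSeq α₀ αs) ≤ K (replicate n 1 ++ (2 ∷ [])))
    × (K (replicate n 1 ++ (2 ∷ [])) ≡ K (2 ∷ replicate n 1))
    × (K (2 ∷ replicate n 1) ≡ F (n + 1))
    × (K (lhsSeq α₀ αs) ≡ K (replicate n 1 ++ (2 ∷ []))
        ⇔ ((length αs ≡ n × α₀ ≡ 0 × All (λ a → a ≡ 1) αs)
           ⊎ (length αs + 1 ≡ n × α₀ ≡ 1 × All (λ a → a ≡ 1) αs)))
theorem5p3 n α₀ αs pos total =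
  ≤-trans (K-bound lhs-pos) (≤-reflexive peak) ,
  trans (K-ones-two n) (sym (K-two-ones n)) ,
  trans (K-two-ones n) (sym (F-succ n)) ,
  ⇔-trans (mk⇔ (λ e → trans e (sym peak)) (λ e → trans e peak))
    (⇔-trans (K-extremal⇔ lhs-pos) (⇔-trans (lhsSeq-extremal⇔ α₀ pos) (condition⇔ total)))
  where
  lhs-pos : AllPositive (lhsSeq α₀ αs)
  lhs-pos = lhsSeq-positive α₀ αs pos
  peak : fib (sum (lhsSeq α₀ αs)) ≡ K (replicate n 1 ++ 2 ∷ [])
  peak = trans (cong fib (trans (lhsSeq-sum α₀ αs) (cong (2 +_) total))) (sym (K-ones-two n))
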